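{- $\chi_i(C_4\Box C_5)\le 6$ and $\chi_i(C_7\Box C_7)\le 6$.
   Context: For a graph $G$, an incidence is a pair $(v,e)$ with $v\in V(G)$, $e\in E(G)$ and $v$ incident with $e$. Two incidences $(v,e)$ and $(w,f)$ are adjacent if $v=w$, or $e=f$, or the edge $vw$ equals $e$ or $f$. An incidence $k$-coloring of $G$ is a map from the set of incidences of $G$ to a set of $k$ colors such that adjacent incidences receive distinct colors; $\chi_i(G)$ is the least $k$ for which such a coloring exists. $C_n$ is the cycle on $n$ vertices and $\Box$ denotes the Cartesian product of graphs. -}

module Defs where

open import Data.Nat using (ℕ; suc; _+_; NonZero)
open import Data.Nat.DivMod using (_%_)
open import Data.Fin using (Fin; toℕ)
open import Data.Product using (Σ; _×_; _,_; proj₁; proj₂)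
open import Data.Sum using (_⊎_)
open import Relation.Binary.PropositionalEquality using (_≡_)
open import Relation.Nullary using (¬_)

record Graph : Set₁ where
  field
    V   : Set
    Adj : V → V → Set

open Graph public

C : (n : ℕ) → .{{_ : NonZero n}} → Graph
C n = record
  { V   = Fin n
  ; Adj = λ i j → ((toℕ i + 1) % n ≡ toℕ j) ⊎ ((toℕ j + 1) % n ≡ toℕ i)
  }

_□_ : Graph → Graph → Graph
G □ H = record
  { V   = V G × V H
  ; Adj = λ p q → (proj₁ p ≡ proj₁ q × Adj H (proj₂ p) (proj₂ q))
                ⊎ (proj₂ p ≡ proj₂ q × Adj G (proj₁ p) (proj₁ q))
  }

-- An incidence (v, e) with e = vu is encoded as the ordered pair (v , u) with v ~ u.
Incidence : Graph → Set
Incidence G = Σ (V G × V G) λ p → Adj G (proj₁ p) (proj₂ p)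

module _ {G : Graph} where
  vert : Incidence G → V G
  vert i = proj₁ (proj₁ i)

  other : Incidence G → V G
  other i = proj₂ (proj₁ i)

  SameEdge : V G → V G → V G → V G → Set
  SameEdge a b c d = (a ≡ c × b ≡ d) ⊎ (a ≡ d × b ≡ c)

  SameInc : Incidence G → Incidence G → Set
  SameInc i j = vert i ≡ vert j × SameEdge (vert i) (other i) (vert j) (other j)

  -- (v,e) and (w,f) adjacent: v = w, or e = f, or the edge vw equals e or f
  IncAdj : Incidence G → Incidence G → Set
  IncAdj i j =
      vert i ≡ vert j
    ⊎ SameEdge (vert i) (other i) (vert j) (other j)
    ⊎ SameEdge (vert i) (vert j) (vert i) (other i)
    ⊎ SameEdge (vert i) (vert j) (vert j) (other j)

IsIncidenceColoring : (G : Graph) (k : ℕ) → (Incidence G → Fin k) → Set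
IsIncidenceColoring G k c =
  (i j : Incidence G) → ¬ SameInc {G} i j → IncAdj {G} i j → ¬ (c i ≡ c j)

χᵢ≤ : Graph → ℕ → Set
χᵢ≤ G k = Σ (Incidence G → Fin k) λ c → IsIncidenceColoring G k c

-- An incidence colouring of a graph is the same thing as a colouring of its arcs (v , u) in which
-- the arcs leaving a vertex get distinct colours and no arc v → u shares its colour with an arc
-- u → w leaving its head (this includes the reverse arc u → v).  On the torus C n □ C m every vertex
-- has the four neighbours obtained by a step in each direction, so an arc colouring is a table
-- assigning six colours to the 4nm pairs (vertex, direction), and for n, m = 4, 5 and 7, 7 the two
-- conditions are finitely many inequalities that are checked by evaluation.
module Submission where

open import Defs
open import Data.Nat using (ℕ; NonZero)
open import Data.Product using (_×_)

open import Data.Nat as ℕ using (_+_; _*_; _%_; _<_)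
open import Data.Nat.DivMod using (_mod_; %-distribˡ-+; [m+n]%n≡m%n; m<n⇒m%n≡m)
open import Data.Nat.Properties using (+-assoc; n<1+n)
open import Data.Fin using (Fin; zero; suc; toℕ)
open import Data.Fin.Properties using (_≟_; all?; any?; toℕ-injective; toℕ-fromℕ<; toℕ<n)
open import Data.List using (List; []; _∷_; drop; head)
open import Data.Maybe using (fromMaybe)
open import Data.Product using (_,_; ∃-syntax)
open import Data.Product.Properties using (≡-dec)
open import Data.Sum using (_⊎_; inj₁; inj₂)
open import Function using (_∘_)
open import Relation.Binary.PropositionalEquality using (_≡_; _≢_; refl; sym; trans; cong; module ≡-Reasoning)
open import Relation.Nullary using (Dec; yes; no; ¬_; ¬?; _→-dec_; _×-dec_)
open import Relation.Nullary.Decidable using (True; toWitness; map′)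

Loopless : Graph → Set
Loopless G = ∀ {v} → ¬ Adj G v v

arcColouring : (G : Graph) {k : ℕ} → (V G → V G → Fin k) → Incidence G → Fin k
arcColouring G c i = c (vert {G} i) (other {G} i)

module _ (G : Graph) {k : ℕ} (c : V G → V G → Fin k) where

  ProperAtVertices : Set
  ProperAtVertices = ∀ {v u u′} → Adj G v u → Adj G v u′ → u ≢ u′ → c v u ≢ c v u′

  ProperAlongPaths : Set
  ProperAlongPaths = ∀ {v u w} → Adj G v u → Adj G u w → c v u ≢ c u w

  arcColouring-isIncidenceColoring : Loopless G → ProperAtVertices → ProperAlongPaths →
                                     IsIncidenceColoring G k (arcColouring G c)
  arcColouring-isIncidenceColoring loopless atVertices alongPaths
    ((v , u) , vu) ((w , x) , wx) distinct = cases
    where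
    cases : IncAdj {G} ((v , u) , vu) ((w , x) , wx) → c v u ≢ c w x
    cases (inj₁ refl) = atVertices vu wx (λ u≡x → distinct (refl , inj₁ (refl , u≡x)))
    cases (inj₂ (inj₁ (inj₁ (v≡w , u≡x)))) = λ _ → distinct (v≡w , inj₁ (v≡w , u≡x))
    cases (inj₂ (inj₁ (inj₂ (refl , refl)))) = alongPaths vu wx
    cases (inj₂ (inj₂ (inj₁ (inj₁ (_ , refl))))) = alongPaths vu wx
    cases (inj₂ (inj₂ (inj₁ (inj₂ (refl , _))))) = λ _ → loopless vu
    cases (inj₂ (inj₂ (inj₂ (inj₁ (_ , refl))))) = λ _ → loopless wx
    cases (inj₂ (inj₂ (inj₂ (inj₂ (refl , _))))) = alongPaths wx vu ∘ sym

module _ (G : Graph) {r : ℕ} (step : V G → Fin r → V G) where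

  EnumeratesNeighbours : Set
  EnumeratesNeighbours = ∀ {v u} → Adj G v u → ∃[ d ] u ≡ step v d

  module _ {k : ℕ} (c : V G → V G → Fin k) where

    StepConditions : Set
    StepConditions = (∀ v d → step v d ≢ v)
                   × (∀ v d e → step v d ≢ step v e → c v (step v d) ≢ c v (step v e))
                   × (∀ v d e → c v (step v d) ≢ c (step v d) (step (step v d) e))

    stepConditions-isIncidenceColoring : EnumeratesNeighbours → StepConditions →
                                         IsIncidenceColoring G k (arcColouring G c)
    stepConditions-isIncidenceColoring enum (noLoop , atVertices , alongPaths) =
      arcColouring-isIncidenceColoring G c loopless properAtVertices properAlongPaths
      where
      loopless : Loopless G
      loopless {v} vv with enum vv
      ... | d , v≡step = noLoop v d (sym v≡step)

      properAtVertices : ProperAtVertices G c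
      properAtVertices {v} vu vu′ with enum vu | enum vu′
      ... | d , refl | e , refl = atVertices v d e

      properAlongPaths : ProperAlongPaths G c
      properAlongPaths {v} vu uw with enum vu
      ... | d , refl with enum uw
      ...   | e , refl = alongPaths v d e

m<n⇒[[m+1]%n+pred[n]]%n≡m : ∀ {m n} .{{_ : NonZero n}} → m < n → ((m + 1) % n + ℕ.pred n) % n ≡ m
m<n⇒[[m+1]%n+pred[n]]%n≡m {m} {n@(ℕ.suc n-1)} m<n = begin
  ((m + 1) % n + n-1) % n          ≡⟨ cong (λ t → ((m + 1) % n + t) % n) (m<n⇒m%n≡m (n<1+n n-1)) ⟨
  ((m + 1) % n + n-1 % n) % n      ≡⟨ %-distribˡ-+ (m + 1) n-1 n ⟨
  (m + 1 + n-1) % n                ≡⟨ cong (_% n) (+-assoc m 1 n-1) ⟩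
  (m + n) % n                      ≡⟨ [m+n]%n≡m%n m n ⟩
  m % n                            ≡⟨ m<n⇒m%n≡m m<n ⟩
  m                                ∎
  where open ≡-Reasoning

module _ {k : ℕ} .{{_ : NonZero k}} where

  next prev : Fin k → Fin k
  next a = (toℕ a + 1) mod k
  prev a = (toℕ a + ℕ.pred k) mod k

  C-neighbours : ∀ {a b} → Adj (C k) a b → b ≡ next a ⊎ b ≡ prev a
  C-neighbours {a} {b} (inj₁ a+1≡b) = inj₁ (toℕ-injective (trans (sym a+1≡b) (sym (toℕ-fromℕ< _))))
  C-neighbours {a} {b} (inj₂ b+1≡a) = inj₂ (toℕ-injective (begin
    toℕ b                            ≡⟨ m<n⇒[[m+1]%n+pred[n]]%n≡m (toℕ<n b) ⟨
    ((toℕ b + 1) % k + ℕ.pred k) % k ≡⟨ cong (λ t → (t + ℕ.pred k) % k) b+1≡a ⟩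
    (toℕ a + ℕ.pred k) % k           ≡⟨ toℕ-fromℕ< _ ⟨
    toℕ (prev a)                     ∎))
    where open ≡-Reasoning

module _ {n m : ℕ} .{{_ : NonZero n}} .{{_ : NonZero m}} where

  torusStep : Fin n × Fin m → Fin 4 → Fin n × Fin m
  torusStep (a , b) zero                   = next a , b
  torusStep (a , b) (suc zero)             = prev a , b
  torusStep (a , b) (suc (suc zero))       = a , next b
  torusStep (a , b) (suc (suc (suc zero))) = a , prev b

  torusStep-enumeratesNeighbours : EnumeratesNeighbours (C n □ C m) torusStep
  torusStep-enumeratesNeighbours (inj₁ (refl , bb′)) with C-neighbours bb′
  ... | inj₁ refl = suc (suc zero) , refl
  ... | inj₂ refl = suc (suc (suc zero)) , refl
  torusStep-enumeratesNeighbours (inj₂ (refl , aa′)) with C-neighbours aa′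
  ... | inj₁ refl = zero , refl
  ... | inj₂ refl = suc zero , refl

  _≟ᵥ_ : (v w : Fin n × Fin m) → Dec (v ≡ w)
  _≟ᵥ_ = ≡-dec _≟_ _≟_

  allVertices? : {P : Fin n × Fin m → Set} → (∀ v → Dec (P v)) → Dec (∀ v → P v)
  allVertices? P? = map′ (λ h → λ { (a , b) → h a b }) (λ h a b → h (a , b))
                         (all? λ a → all? λ b → P? (a , b))

  -- Non-neighbours get the junk direction zero; their colour is never used.
  direction : (v u : Fin n × Fin m) → Fin 4
  direction v u with any? (λ d → u ≟ᵥ torusStep v d)
  ... | yes (d , _) = d
  ... | no _        = zero

  -- Entry ((a · m + b) · 4 + d) of the table, read modulo 6, colours the arc from (a , b) in direction d.
  tableColouring : List ℕ → (v u : Fin n × Fin m) → Fin 6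
  tableColouring table v@(a , b) u =
    fromMaybe 0 (head (drop ((toℕ a * m + toℕ b) * 4 + toℕ (direction v u)) table)) mod 6

  stepConditions? : (c : Fin n × Fin m → Fin n × Fin m → Fin 6) →
                    Dec (StepConditions (C n □ C m) torusStep c)
  stepConditions? c =
        allVertices? (λ v → all? λ d → ¬? (torusStep v d ≟ᵥ v))
    ×-dec allVertices? (λ v → all? λ d → all? λ e →
            ¬? (torusStep v d ≟ᵥ torusStep v e) →-dec ¬? (c v (torusStep v d) ≟ c v (torusStep v e)))
    ×-dec allVertices? (λ v → all? λ d → all? λ e → let u = torusStep v d in
            ¬? (c v u ≟ c u (torusStep u e)))

  torus-χᵢ≤6 : (table : List ℕ) → True (stepConditions? (tableColouring table)) → χᵢ≤ (C n □ C m) 6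
  torus-χᵢ≤6 table valid =
    arcColouring _ (tableColouring table) ,
    stepConditions-isIncidenceColoring _ torusStep (tableColouring table)
      torusStep-enumeratesNeighbours (toWitness valid)

table₄₅ : List ℕ
table₄₅ = 0 ∷ 1 ∷ 2 ∷ 3 ∷ 0 ∷ 1 ∷ 3 ∷ 4 ∷ 1 ∷ 0 ∷ 4 ∷ 2 ∷ 0 ∷ 1 ∷ 5 ∷ 3 ∷ 1 ∷ 0 ∷ 4 ∷ 2 ∷ 2 ∷ 4 ∷ 1 ∷ 5 ∷ 4 ∷ 2 ∷ 5 ∷ 3 ∷ 2 ∷ 3 ∷ 4 ∷ 0 ∷ 3 ∷ 2 ∷ 5 ∷ 1 ∷ 2 ∷ 3 ∷ 0 ∷ 4 ∷ 1 ∷ 0 ∷ 3 ∷ 4 ∷ 1 ∷ 0 ∷ 2 ∷ 5 ∷ 0 ∷ 1 ∷ 4 ∷ 3 ∷ 1 ∷ 0 ∷ 2 ∷ 5 ∷ 0 ∷ 1 ∷ 5 ∷ 3 ∷ 4 ∷ 2 ∷ 3 ∷ 0 ∷ 2 ∷ 4 ∷ 0 ∷ 5 ∷ 3 ∷ 2 ∷ 4 ∷ 1 ∷ 2 ∷ 3 ∷ 0 ∷ 5 ∷ 3 ∷ 2 ∷ 1 ∷ 4 ∷ []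

table₇₇ : List ℕ
table₇₇ = 0 ∷ 1 ∷ 2 ∷ 3 ∷ 0 ∷ 1 ∷ 3 ∷ 4 ∷ 1 ∷ 0 ∷ 4 ∷ 2 ∷ 0 ∷ 1 ∷ 5 ∷ 3 ∷ 1 ∷ 0 ∷ 4 ∷ 2 ∷ 0 ∷ 1 ∷ 5 ∷ 3 ∷ 1 ∷ 0 ∷ 4 ∷ 2 ∷ 2 ∷ 4 ∷ 1 ∷ 5 ∷ 4 ∷ 2 ∷ 5 ∷ 3 ∷ 2 ∷ 3 ∷ 4 ∷ 0 ∷ 3 ∷ 2 ∷ 5 ∷ 1 ∷ 2 ∷ 3 ∷ 4 ∷ 0 ∷ 3 ∷ 2 ∷ 5 ∷ 1 ∷ 2 ∷ 3 ∷ 0 ∷ 4 ∷ 1 ∷ 0 ∷ 5 ∷ 3 ∷ 1 ∷ 0 ∷ 3 ∷ 2 ∷ 0 ∷ 1 ∷ 5 ∷ 4 ∷ 1 ∷ 0 ∷ 4 ∷ 2 ∷ 0 ∷ 1 ∷ 3 ∷ 5 ∷ 1 ∷ 0 ∷ 2 ∷ 4 ∷ 0 ∷ 1 ∷ 4 ∷ 5 ∷ 3 ∷ 2 ∷ 0 ∷ 4 ∷ 2 ∷ 4 ∷ 3 ∷ 5 ∷ 4 ∷ 2 ∷ 5 ∷ 1 ∷ 2 ∷ 3 ∷ 4 ∷ 0 ∷ 3 ∷ 2 ∷ 1 ∷ 5 ∷ 2 ∷ 3 ∷ 4 ∷ 0 ∷ 3 ∷ 2 ∷ 1 ∷ 5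 ∷ 0 ∷ 1 ∷ 2 ∷ 4 ∷ 4 ∷ 0 ∷ 5 ∷ 3 ∷ 3 ∷ 0 ∷ 2 ∷ 1 ∷ 0 ∷ 1 ∷ 3 ∷ 4 ∷ 1 ∷ 0 ∷ 2 ∷ 5 ∷ 0 ∷ 1 ∷ 3 ∷ 4 ∷ 1 ∷ 0 ∷ 5 ∷ 2 ∷ 1 ∷ 3 ∷ 2 ∷ 5 ∷ 5 ∷ 1 ∷ 3 ∷ 0 ∷ 1 ∷ 5 ∷ 0 ∷ 4 ∷ 4 ∷ 5 ∷ 1 ∷ 2 ∷ 5 ∷ 4 ∷ 0 ∷ 3 ∷ 4 ∷ 2 ∷ 5 ∷ 1 ∷ 2 ∷ 3 ∷ 4 ∷ 0 ∷ 4 ∷ 0 ∷ 5 ∷ 2 ∷ 2 ∷ 4 ∷ 0 ∷ 3 ∷ 3 ∷ 2 ∷ 4 ∷ 5 ∷ 2 ∷ 3 ∷ 5 ∷ 0 ∷ 3 ∷ 2 ∷ 1 ∷ 4 ∷ 2 ∷ 3 ∷ 0 ∷ 5 ∷ 3 ∷ 5 ∷ 1 ∷ 4 ∷ []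

lemma4 : χᵢ≤ (C 4 □ C 5) 6 × χᵢ≤ (C 7 □ C 7) 6
lemma4 = torus-χᵢ≤6 table₄₅ _ , torus-χᵢ≤6 table₇₇ _
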